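{- Let $G$ be a connected graph with $n$ vertices. Then $G$ is $1$-metamour-regular if and only if $n\ge4$ is even and either (a) $G=P_4$, or (b) $G=K_n-\mu$ for some perfect matching $\mu$ of $K_n$.
   Context: All graphs are finite, simple and have at least one vertex; isomorphic graphs are regarded as equal. A vertex $v$ is a metamour of a vertex $w$ in $G$ if their distance in $G$ equals $2$. $G$ is $1$-metamour-regular if every vertex has exactly one metamour. $P_4$ is the path on $4$ vertices. For a set $\nu$ of edges, $G-\nu$ is the graph with the same vertices and edge set $E(G)\setminus\nu$. -}

module Defs where

open import Data.Nat using (ℕ; zero; suc; _<_; _≥_)
open import Data.Fin using (Fin)
open import Data.Bool using (Bool; true; false; _∧_; not)
open import Data.Product using (Σ; ∃; _×_; _,_)
open import Relation.Binary.PropositionalEquality using (_≡_; _≢_)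
open import Relation.Nullary using (¬_)
open import Function.Bundles using (_↔_; Inverse)
open import Relation.Nullary.Decidable using (⌊_⌋)
open import Data.Fin using (_≟_)

record Graph (n : ℕ) : Set where
  field
    adj   : Fin n → Fin n → Bool
    adjSym    : ∀ u v → adj u v ≡ adj v u
    adjIrrefl : ∀ v → adj v v ≡ false
open Graph public

_∼[_]_ : ∀ {n} → Fin n → Graph n → Fin n → Set
u ∼[ G ] v = adj G u v ≡ true

data Walk {n : ℕ} (G : Graph n) : Fin n → Fin n → ℕ → Set where
  here : ∀ {v} → Walk G v v zero
  step : ∀ {u v w k} → u ∼[ G ] v → Walk G v w k → Walk G u w (suc k)

Dist : ∀ {n} → Graph n → Fin n → Fin n → ℕ → Set
Dist G v w d = Walk G v w d × (∀ j → j < d → ¬ Walk G v w j)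

Connected : ∀ {n} → Graph n → Set
Connected G = ∀ v w → ∃ λ k → Walk G v w k

Metamour : ∀ {n} → Graph n → Fin n → Fin n → Set
Metamour G v w = Dist G v w 2

OneMetamourRegular : ∀ {n} → Graph n → Set
OneMetamourRegular G =
  ∀ v → Σ _ λ m → Metamour G v m × (∀ m′ → Metamour G v m′ → m′ ≡ m)

record _≅_ {n m : ℕ} (G : Graph n) (H : Graph m) : Set where
  field
    bij      : Fin n ↔ Fin m
    preserves : ∀ u v → adj H (Inverse.to bij u) (Inverse.to bij v) ≡ adj G u v

-- Path on 4 vertices: 0 - 1 - 2 - 3
p4adj : Fin 4 → Fin 4 → Bool
p4adj Fin.zero (Fin.suc Fin.zero) = true
p4adj (Fin.suc Fin.zero) Fin.zero = true
p4adj (Fin.suc Fin.zero) (Fin.suc (Fin.suc Fin.zero)) = true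
p4adj (Fin.suc (Fin.suc Fin.zero)) (Fin.suc Fin.zero) = true
p4adj (Fin.suc (Fin.suc Fin.zero)) (Fin.suc (Fin.suc (Fin.suc Fin.zero))) = true
p4adj (Fin.suc (Fin.suc (Fin.suc Fin.zero))) (Fin.suc (Fin.suc Fin.zero)) = true
p4adj _ _ = false

P4 : Graph 4
P4 = record { adj = p4adj ; adjSym = s ; adjIrrefl = i }
  where
  s : ∀ u v → p4adj u v ≡ p4adj v u
  s Fin.zero Fin.zero = _≡_.refl
  s Fin.zero (Fin.suc Fin.zero) = _≡_.refl
  s Fin.zero (Fin.suc (Fin.suc Fin.zero)) = _≡_.refl
  s Fin.zero (Fin.suc (Fin.suc (Fin.suc Fin.zero))) = _≡_.refl
  s (Fin.suc Fin.zero) Fin.zero = _≡_.refl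
  s (Fin.suc Fin.zero) (Fin.suc Fin.zero) = _≡_.refl
  s (Fin.suc Fin.zero) (Fin.suc (Fin.suc Fin.zero)) = _≡_.refl
  s (Fin.suc Fin.zero) (Fin.suc (Fin.suc (Fin.suc Fin.zero))) = _≡_.refl
  s (Fin.suc (Fin.suc Fin.zero)) Fin.zero = _≡_.refl
  s (Fin.suc (Fin.suc Fin.zero)) (Fin.suc Fin.zero) = _≡_.refl
  s (Fin.suc (Fin.suc Fin.zero)) (Fin.suc (Fin.suc Fin.zero)) = _≡_.refl
  s (Fin.suc (Fin.suc Fin.zero)) (Fin.suc (Fin.suc (Fin.suc Fin.zero))) = _≡_.refl
  s (Fin.suc (Fin.suc (Fin.suc Fin.zero))) Fin.zero = _≡_.refl
  s (Fin.suc (Fin.suc (Fin.suc Fin.zero))) (Fin.suc Fin.zero) = _≡_.refl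
  s (Fin.suc (Fin.suc (Fin.suc Fin.zero))) (Fin.suc (Fin.suc Fin.zero)) = _≡_.refl
  s (Fin.suc (Fin.suc (Fin.suc Fin.zero))) (Fin.suc (Fin.suc (Fin.suc Fin.zero))) = _≡_.refl
  i : ∀ v → p4adj v v ≡ false
  i Fin.zero = _≡_.refl
  i (Fin.suc Fin.zero) = _≡_.refl
  i (Fin.suc (Fin.suc Fin.zero)) = _≡_.refl
  i (Fin.suc (Fin.suc (Fin.suc Fin.zero))) = _≡_.refl

record EdgeSet (n : ℕ) : Set where
  field
    mem    : Fin n → Fin n → Bool
    memSym : ∀ u v → mem u v ≡ mem v u
    memIrr : ∀ v → mem v v ≡ false
open EdgeSet public

PerfectMatching : ∀ {n} → EdgeSet n → Set
PerfectMatching {n} μ =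
  ∀ v → Σ (Fin n) λ w → mem μ v w ≡ true × (∀ w′ → mem μ v w′ ≡ true → w′ ≡ w)

Kadj : ∀ {n} → Fin n → Fin n → Bool
Kadj u v = not ⌊ u ≟ v ⌋

_minus_ : ∀ {n} → Graph n → EdgeSet n → Graph n
_minus_ {n} G ν = record
  { adj = λ u v → adj G u v ∧ not (mem ν u v)
  ; adjSym = λ u v → cong2 (adjSym G u v) (memSym ν u v)
  ; adjIrrefl = λ v → rw (adjIrrefl G v)
  }
  where
  open import Relation.Binary.PropositionalEquality using (cong₂; refl)
  cong2 : ∀ {a b c d : Bool} → a ≡ b → c ≡ d → a ∧ not c ≡ b ∧ not d
  cong2 refl refl = refl
  rw : ∀ {a c : Bool} → a ≡ false → a ∧ not c ≡ false
  rw refl = refl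

K : (n : ℕ) → Graph n
K n = record { adj = Kadj ; adjSym = ks ; adjIrrefl = ki }
  where
  open import Relation.Binary.PropositionalEquality using (refl; cong)
  open import Relation.Nullary using (yes; no)
  open import Relation.Binary.PropositionalEquality using (sym)
  ks : ∀ (u v : Fin n) → Kadj u v ≡ Kadj v u
  ks u v with u ≟ v | v ≟ u
  ... | yes _ | yes _ = refl
  ... | no _ | no _ = refl
  ... | yes p | no q = Data.Empty.⊥-elim (q (sym p))
    where import Data.Empty
  ... | no p | yes q = Data.Empty.⊥-elim (p (sym q))
    where import Data.Empty
  ki : ∀ (v : Fin n) → Kadj v v ≡ false
  ki v with v ≟ v
  ... | yes _ = refl
  ... | no p = Data.Empty.⊥-elim (p refl)
    where import Data.Empty

-- In a 1-metamour-regular graph "being the metamour of" is a fixed-point-free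
-- involution on the vertices, so n is even, and n ≥ 3 because a vertex, its
-- metamour and a common neighbour are distinct. If every two distinct
-- non-adjacent vertices have a common neighbour, the non-edges are exactly the
-- metamour pairs, i.e. a perfect matching μ, and G = K_n − μ. Otherwise a walk
-- between two vertices at distance ≥ 3, followed until it first comes within
-- distance 2 of its end, yields an induced path u–a–b–w with u, w at distance
-- 3. Its metamour pairs are {u,b} and {a,w}, so by uniqueness of metamours a
-- vertex off the path that is adjacent to one path vertex is adjacent to all of
-- them, hence a common neighbour of u and w. So no vertex off the path has a
-- neighbour on it, and by connectedness G is this P₄. Conversely P₄ and, for
-- n ≥ 3, every K_n − μ are checked directly.
module Submission where

open import Defs
open import Data.Nat using (ℕ; _≥_)
open import Data.Nat.Divisibility using (_∣_)
open import Data.Product using (Σ; _×_)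
open import Data.Sum using (_⊎_)
open import Function.Bundles using (_⇔_)

open import Data.Bool using (true; false; not; _∧_)
open import Data.Bool.Properties using (¬-not; not-injective; ∧-zeroʳ) renaming (_≟_ to _≟ᵇ_)
open import Data.Fin using (Fin; zero; suc; punchIn; punchOut; _≟_)
open import Data.Fin.Patterns using (0F; 1F; 2F; 3F)
open import Data.Fin.Properties using (any?; all?; injective⇒≤; suc-injective; punchIn-injective; punchInᵢ≢i; punchIn-punchOut)
open import Data.Nat using (suc; _<_; z≤n; s≤s)
open import Data.Nat.Divisibility using (_∣?_; _∣0; ∣m∣n⇒∣m+n; ∣-refl)
open import Data.Nat.Properties using (<⇒≤)
open import Data.Product using (_,_; proj₁; proj₂; ∃)
open import Data.Sum using (inj₁; inj₂)
open import Function.Base using (_∘_)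
open import Function.Bundles using (Equivalence; Injection; Inverse; mk⇔; mk↔ₛ′)
open import Function.Definitions using (Injective)
open import Function.Properties.Equivalence using () renaming (sym to ⇔-sym)
open import Function.Properties.Inverse using (↔-refl; ↔-sym; Inverse⇒Injection)
open import Relation.Binary.PropositionalEquality
open import Relation.Nullary using (¬_; Dec; yes; no; ¬?; contradiction)
open import Relation.Nullary.Decidable using (_×-dec_; _→-dec_; ⌊_⌋; from-yes; from-no)

module FixedPointFreeInvolution
  {k : ℕ} (f : Fin (suc (suc k)) → Fin (suc (suc k)))
  (involutive : ∀ x → f (f x) ≡ x) (fixedPointFree : ∀ x → f x ≢ x)
  {j : Fin (suc k)} (f0≡1+j : f 0F ≡ suc j) where

  f-injective : ∀ {x y} → f x ≡ f y → x ≡ y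
  f-injective {x} {y} eq = trans (sym (involutive x)) (trans (cong f eq) (involutive y))

  f[1+j]≡0 : f (suc j) ≡ 0F
  f[1+j]≡0 = trans (cong f (sym f0≡1+j)) (involutive 0F)

  -- Fin k is identified with the complement of the orbit {0, suc j}.
  embed : Fin k → Fin (suc (suc k))
  embed x = suc (punchIn j x)

  embed-injective : ∀ {x y} → embed x ≡ embed y → x ≡ y
  embed-injective = punchIn-injective j _ _ ∘ suc-injective

  unembed : ∀ z → z ≢ 0F → z ≢ suc j → ∃ λ x → embed x ≡ z
  unembed zero    z≢0 _     = contradiction refl z≢0
  unembed (suc y) _   y≢1+j = punchOut (y≢1+j ∘ cong suc ∘ sym) , cong suc (punchIn-punchOut _)

  f∘embed≢0 : ∀ x → f (embed x) ≢ 0F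
  f∘embed≢0 x eq = punchInᵢ≢i j x (suc-injective (f-injective (trans eq (sym f[1+j]≡0))))

  f∘embed≢1+j : ∀ x → f (embed x) ≢ suc j
  f∘embed≢1+j x eq = contradiction (f-injective (trans eq (sym f0≡1+j))) λ ()

  restrict : Fin k → Fin k
  restrict x = proj₁ (unembed (f (embed x)) (f∘embed≢0 x) (f∘embed≢1+j x))

  embed∘restrict : ∀ x → embed (restrict x) ≡ f (embed x)
  embed∘restrict x = proj₂ (unembed (f (embed x)) (f∘embed≢0 x) (f∘embed≢1+j x))

  restrict-involutive : ∀ x → restrict (restrict x) ≡ x
  restrict-involutive x = embed-injective (begin
    embed (restrict (restrict x)) ≡⟨ embed∘restrict (restrict x) ⟩
    f (embed (restrict x))        ≡⟨ cong f (embed∘restrict x) ⟩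
    f (f (embed x))               ≡⟨ involutive (embed x) ⟩
    embed x                       ∎)
    where open ≡-Reasoning

  restrict-fixedPointFree : ∀ x → restrict x ≢ x
  restrict-fixedPointFree x eq = fixedPointFree (embed x) (trans (sym (embed∘restrict x)) (cong embed eq))

fixedPointFreeInvolution⇒even : ∀ n (f : Fin n → Fin n) →
  (∀ x → f (f x) ≡ x) → (∀ x → f x ≢ x) → 2 ∣ n
fixedPointFreeInvolution⇒even 0 _ _ _ = 2 ∣0
fixedPointFreeInvolution⇒even 1 f _ fixedPointFree with f 0F in eq
... | 0F = contradiction eq (fixedPointFree 0F)
fixedPointFreeInvolution⇒even (suc (suc k)) f involutive fixedPointFree with f 0F in eq
... | 0F    = contradiction eq (fixedPointFree 0F)
... | suc j = ∣m∣n⇒∣m+n (∣-refl {2})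
  (fixedPointFreeInvolution⇒even k restrict restrict-involutive restrict-fixedPointFree)
  where open FixedPointFreeInvolution f involutive fixedPointFree eq

distinct₃⇒≥3 : ∀ {n} {x y z : Fin n} → x ≢ y → x ≢ z → y ≢ z → n ≥ 3
distinct₃⇒≥3 {x = x} {y} {z} x≢y x≢z y≢z = injective⇒≤ triple-injective
  where
  triple : Fin 3 → _
  triple 0F = x
  triple 1F = y
  triple 2F = z

  triple-injective : Injective _≡_ _≡_ triple
  triple-injective {0F} {0F} _  = refl
  triple-injective {0F} {1F} eq = contradiction eq x≢y
  triple-injective {0F} {2F} eq = contradiction eq x≢z
  triple-injective {1F} {0F} eq = contradiction (sym eq) x≢y
  triple-injective {1F} {1F} _  = refl
  triple-injective {1F} {2F} eq = contradiction eq y≢z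
  triple-injective {2F} {0F} eq = contradiction (sym eq) x≢z
  triple-injective {2F} {1F} eq = contradiction (sym eq) y≢z
  triple-injective {2F} {2F} _  = refl

even∧≥3⇒≥4 : ∀ {n} → 2 ∣ n → n ≥ 3 → n ≥ 4
even∧≥3⇒≥4 {1} _ (s≤s ())
even∧≥3⇒≥4 {2} _ (s≤s (s≤s ()))
even∧≥3⇒≥4 {3} 2∣3 _ = contradiction 2∣3 (from-no (2 ∣? 3))
even∧≥3⇒≥4 {suc (suc (suc (suc _)))} _ _ = s≤s (s≤s (s≤s (s≤s z≤n)))

∃-≢₂ : ∀ {n} → n ≥ 3 → (x z : Fin n) → ∃ λ c → c ≢ x × c ≢ z
∃-≢₂ (s≤s (s≤s (s≤s _))) 0F            0F            = 1F , (λ ()) , (λ ())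
∃-≢₂ (s≤s (s≤s (s≤s _))) 0F            1F            = 2F , (λ ()) , (λ ())
∃-≢₂ (s≤s (s≤s (s≤s _))) 0F            (suc (suc _)) = 1F , (λ ()) , (λ ())
∃-≢₂ (s≤s (s≤s (s≤s _))) 1F            0F            = 2F , (λ ()) , (λ ())
∃-≢₂ (s≤s (s≤s (s≤s _))) (suc (suc _)) 0F            = 1F , (λ ()) , (λ ())
∃-≢₂ (s≤s (s≤s (s≤s _))) (suc _)       (suc _)       = 0F , (λ ()) , (λ ())

-- Metamours without walks

module _ {n : ℕ} (G : Graph n) where

  ∼-sym : ∀ {u w} → u ∼[ G ] w → w ∼[ G ] u
  ∼-sym {u} {w} u∼w = trans (adjSym G w u) u∼w

  ≁-sym : ∀ {u w} → adj G u w ≡ false → adj G w u ≡ false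
  ≁-sym {u} {w} u≁w = trans (adjSym G w u) u≁w

  ∼⇒≢ : ∀ {u w} → u ∼[ G ] w → u ≢ w
  ∼⇒≢ {u} u∼u refl = contradiction (trans (sym u∼u) (adjIrrefl G u)) λ ()

  CommonNeighbour : Fin n → Fin n → Set
  CommonNeighbour u w = ∃ λ c → u ∼[ G ] c × c ∼[ G ] w

  commonNeighbour? : ∀ u w → Dec (CommonNeighbour u w)
  commonNeighbour? u w = any? λ c → (adj G u c ≟ᵇ true) ×-dec (adj G c w ≟ᵇ true)

  commonNeighbour-sym : ∀ {u w} → CommonNeighbour u w → CommonNeighbour w u
  commonNeighbour-sym (c , u∼c , c∼w) = c , ∼-sym c∼w , ∼-sym u∼c

  Metamour′ : Fin n → Fin n → Set
  Metamour′ u w = u ≢ w × adj G u w ≡ false × CommonNeighbour u w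

  metamour′? : ∀ u w → Dec (Metamour′ u w)
  metamour′? u w = ¬? (u ≟ w) ×-dec (adj G u w ≟ᵇ false) ×-dec commonNeighbour? u w

  metamour′-sym : ∀ {u w} → Metamour′ u w → Metamour′ w u
  metamour′-sym (u≢w , u≁w , cn) = u≢w ∘ sym , ≁-sym u≁w , commonNeighbour-sym cn

  metamour⇔metamour′ : ∀ {u w} → Metamour G u w ⇔ Metamour′ u w
  metamour⇔metamour′ {u} {w} = mk⇔ to from
    where
    to : Metamour G u w → Metamour′ u w
    to (step u∼c (step c∼w here) , noShorter) =
      (λ { refl → noShorter 0 (s≤s z≤n) here }) ,
      ¬-not (λ u∼w → noShorter 1 (s≤s (s≤s z≤n)) (step u∼w here)) ,
      (_ , u∼c , c∼w)

    from : Metamour′ u w → Metamour G u w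
    from (u≢w , u≁w , c , u∼c , c∼w) = step u∼c (step c∼w here) , noShorter
      where
      noShorter : ∀ j → j < 2 → ¬ Walk G u w j
      noShorter 0 _ here = u≢w refl
      noShorter 1 _ (step u∼w here) = contradiction (trans (sym u∼w) u≁w) λ ()
      noShorter (suc (suc _)) (s≤s (s≤s ())) _

  -- distance at least 3
  Far : Fin n → Fin n → Set
  Far u w = u ≢ w × adj G u w ≡ false × ¬ CommonNeighbour u w

  far? : ∀ u w → Dec (Far u w)
  far? u w = ¬? (u ≟ w) ×-dec (adj G u w ≟ᵇ false) ×-dec ¬? (commonNeighbour? u w)

  far-sym : ∀ {u w} → Far u w → Far w u
  far-sym (u≢w , u≁w , ¬cn) = u≢w ∘ sym , ≁-sym u≁w , ¬cn ∘ commonNeighbour-sym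

ExactlyOne : ∀ {n} → (Fin n → Set) → Set
ExactlyOne {n} P = Σ (Fin n) λ m → P m × (∀ m′ → P m′ → m′ ≡ m)

exactlyOne-resp-⇔ : ∀ {n} {P Q : Fin n → Set} → (∀ x → P x ⇔ Q x) → ExactlyOne P → ExactlyOne Q
exactlyOne-resp-⇔ P⇔Q (m , Pm , unique) =
  m , Equivalence.to (P⇔Q m) Pm , λ m′ Qm′ → unique m′ (Equivalence.from (P⇔Q m′) Qm′)

OneMetamourRegular′ : ∀ {n} → Graph n → Set
OneMetamourRegular′ G = ∀ v → ExactlyOne (Metamour′ G v)

oneMetamourRegular⇔oneMetamourRegular′ : ∀ {n} (G : Graph n) → OneMetamourRegular G ⇔ OneMetamourRegular′ G
oneMetamourRegular⇔oneMetamourRegular′ G = mk⇔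
  (λ regular v → exactlyOne-resp-⇔ (λ _ → metamour⇔metamour′ G) (regular v))
  (λ regular v → exactlyOne-resp-⇔ (λ _ → ⇔-sym (metamour⇔metamour′ G)) (regular v))

record InducedEmbedding {m n : ℕ} (H : Graph m) (G : Graph n) : Set where
  field
    map       : Fin m → Fin n
    injective : Injective _≡_ _≡_ map
    adj-map   : ∀ i j → adj G (map i) (map j) ≡ adj H i j

module _ {m n : ℕ} {H : Graph m} {G : Graph n} (e : InducedEmbedding H G) where
  open InducedEmbedding e

  ∼-map : ∀ {i j} → i ∼[ H ] j → map i ∼[ G ] map j
  ∼-map {i} {j} i∼j = trans (adj-map i j) i∼j

  metamour′-map : ∀ {i j} → Metamour′ H i j → Metamour′ G (map i) (map j)
  metamour′-map {i} {j} (i≢j , i≁j , c , i∼c , c∼j) =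
    i≢j ∘ injective , trans (adj-map i j) i≁j , map c , ∼-map i∼c , ∼-map c∼j

  surjective⇒≅ : (∀ y → ∃ λ i → map i ≡ y) → G ≅ H
  surjective⇒≅ surjective = record
    { bij       = mk↔ₛ′ index map (λ i → injective (map∘index (map i))) map∘index
    ; preserves = preserves
    }
    where
    index : Fin n → Fin m
    index y = proj₁ (surjective y)

    map∘index : ∀ y → map (index y) ≡ y
    map∘index y = proj₂ (surjective y)

    preserves : ∀ u v → adj H (index u) (index v) ≡ adj G u v
    preserves u v = trans (sym (adj-map (index u) (index v))) (cong₂ (adj G) (map∘index u) (map∘index v))

module _ {m n : ℕ} {G : Graph m} {H : Graph n} (G≅H : G ≅ H) where
  open _≅_ G≅H
  open Inverse bij

  ≅⇒embedding : InducedEmbedding G H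
  ≅⇒embedding = record
    { map       = to
    ; injective = Injection.injective (Inverse⇒Injection bij)
    ; adj-map   = preserves
    }

  ≅-sym : H ≅ G
  ≅-sym = record
    { bij       = ↔-sym bij
    ; preserves = λ u v → trans (sym (preserves (from u) (from v)))
                                (cong₂ (adj H) (strictlyInverseˡ u) (strictlyInverseˡ v))
    }

oneMetamourRegular′-resp-≅ : ∀ {m n} {G : Graph m} {H : Graph n} →
  G ≅ H → OneMetamourRegular′ H → OneMetamourRegular′ G
oneMetamourRegular′-resp-≅ {G = G} G≅H regular x =
  let m , metamour , unique = regular (to x) in
  from m ,
  subst (λ y → Metamour′ G y (from m)) (strictlyInverseʳ x)
    (metamour′-map (≅⇒embedding (≅-sym G≅H)) metamour) ,
  λ m′ metamour′ → trans (sym (strictlyInverseʳ m′))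
    (cong from (unique (to m′) (metamour′-map (≅⇒embedding G≅H) metamour′)))
  where open Inverse (_≅_.bij G≅H)

TwinFree : ∀ {m} → Graph m → Set
TwinFree {m} H = ∀ (i j : Fin m) → (∀ k → adj H i k ≡ adj H j k) → i ≡ j

twinFree⇒embedding : ∀ {m n} {H : Graph m} {G : Graph n} → TwinFree H →
  (φ : Fin m → Fin n) → (∀ i j → adj G (φ i) (φ j) ≡ adj H i j) → InducedEmbedding H G
twinFree⇒embedding {H = H} {G} twinFree φ adj-φ = record
  { map       = φ
  ; injective = λ {i} {j} φi≡φj → twinFree i j λ k →
      trans (sym (adj-φ i k)) (trans (cong (λ x → adj G x (φ k)) φi≡φj) (adj-φ j k))
  ; adj-map   = adj-φ
  }

P4-twinFree : TwinFree P4
P4-twinFree = from-yes (all? λ i → all? λ j → all? (λ k → p4adj i k ≟ᵇ p4adj j k) →-dec (i ≟ j))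

P4-partner : Fin 4 → Fin 4
P4-partner 0F = 2F
P4-partner 1F = 3F
P4-partner 2F = 0F
P4-partner 3F = 1F

P4-metamour′-partner : ∀ i → Metamour′ P4 i (P4-partner i)
P4-metamour′-partner = from-yes (all? λ i → metamour′? P4 i (P4-partner i))

P4-metamour′⇒partner : ∀ i j → Metamour′ P4 i j → j ≡ P4-partner i
P4-metamour′⇒partner = from-yes (all? λ i → all? λ j → metamour′? P4 i j →-dec (j ≟ P4-partner i))

P4-oneMetamourRegular′ : OneMetamourRegular′ P4
P4-oneMetamourRegular′ i = P4-partner i , P4-metamour′-partner i , P4-metamour′⇒partner i

module _ {n : ℕ} {μ : EdgeSet n} (perfect : PerfectMatching μ) where

  private
    partner : Fin n → Fin n
    partner x = proj₁ (perfect x)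

    partner-unique : ∀ x {z} → mem μ x z ≡ true → z ≡ partner x
    partner-unique x {z} = proj₂ (proj₂ (perfect x)) z

    mem-sym : ∀ {x z} → mem μ x z ≡ true → mem μ z x ≡ true
    mem-sym {x} {z} = trans (memSym μ z x)

  K-minus-∼ : ∀ {x z} → x ≢ z → mem μ x z ≡ false → x ∼[ K n minus μ ] z
  K-minus-∼ {x} {z} x≢z xz∉μ with x ≟ z
  ... | yes x≡z = contradiction x≡z x≢z
  ... | no _    rewrite xz∉μ = refl

  mem⇒K-minus-metamour′ : n ≥ 3 → ∀ {x z} → mem μ x z ≡ true → Metamour′ (K n minus μ) x z
  mem⇒K-minus-metamour′ n≥3 {x} {z} xz∈μ with ∃-≢₂ n≥3 x z
  ... | c , c≢x , c≢z = x≢z , x≁z , c , K-minus-∼ (c≢x ∘ sym) xc∉μ , K-minus-∼ c≢z cz∉μ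
    where
    x≢z : x ≢ z
    x≢z refl = contradiction (trans (sym xz∈μ) (memIrr μ x)) λ ()

    x≁z : adj (K n minus μ) x z ≡ false
    x≁z = trans (cong (λ b → not ⌊ x ≟ z ⌋ ∧ not b) xz∈μ) (∧-zeroʳ _)

    xc∉μ : mem μ x c ≡ false
    xc∉μ = ¬-not λ xc∈μ → c≢z (trans (partner-unique x xc∈μ) (sym (partner-unique x xz∈μ)))

    cz∉μ : mem μ c z ≡ false
    cz∉μ = ¬-not λ cz∈μ →
      c≢x (trans (partner-unique z (mem-sym cz∈μ)) (sym (partner-unique z (mem-sym xz∈μ))))

  K-minus-metamour′⇒mem : ∀ {x z} → Metamour′ (K n minus μ) x z → mem μ x z ≡ true
  K-minus-metamour′⇒mem {x} {z} (x≢z , x≁z , _) with x ≟ z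
  ... | yes x≡z = contradiction x≡z x≢z
  ... | no _    = not-injective x≁z

  K-minus-oneMetamourRegular′ : n ≥ 3 → OneMetamourRegular′ (K n minus μ)
  K-minus-oneMetamourRegular′ n≥3 x =
    partner x ,
    mem⇒K-minus-metamour′ n≥3 (proj₁ (proj₂ (perfect x))) ,
    λ z xz-metamour → partner-unique x (K-minus-metamour′⇒mem xz-metamour)

-- One-metamour-regular graphs

module _ {n : ℕ} (G : Graph n) (regular : OneMetamourRegular′ G) where

  metamour : Fin n → Fin n
  metamour v = proj₁ (regular v)

  metamour-metamour′ : ∀ v → Metamour′ G v (metamour v)
  metamour-metamour′ v = proj₁ (proj₂ (regular v))

  metamour-unique : ∀ {v x} → Metamour′ G v x → x ≡ metamour v
  metamour-unique {v} {x} = proj₂ (proj₂ (regular v)) x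

  metamour-involutive : ∀ v → metamour (metamour v) ≡ v
  metamour-involutive v = sym (metamour-unique (metamour′-sym G (metamour-metamour′ v)))

  metamour-fixedPointFree : ∀ v → metamour v ≢ v
  metamour-fixedPointFree v m≡v = proj₁ (metamour-metamour′ v) (sym m≡v)

  oneMetamourRegular′⇒even : 2 ∣ n
  oneMetamourRegular′⇒even = fixedPointFreeInvolution⇒even n metamour metamour-involutive metamour-fixedPointFree

  oneMetamourRegular′⇒≥3 : Fin n → n ≥ 3
  oneMetamourRegular′⇒≥3 v with metamour-metamour′ v
  ... | v≢m , _ , c , v∼c , c∼m = distinct₃⇒≥3 v≢m (∼⇒≢ G v∼c) (∼⇒≢ G c∼m ∘ sym)

record FarEndedP4 {n : ℕ} (G : Graph n) : Set where
  field
    vertex     : Fin 4 → Fin n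
    vertex-adj : ∀ i j → adj G (vertex i) (vertex j) ≡ p4adj i j
    ends-far   : Far G (vertex 0F) (vertex 3F)

module _ {n : ℕ} {G : Graph n} where

  farEndedP4 : ∀ {u a b w} → u ∼[ G ] a → a ∼[ G ] b → b ∼[ G ] w →
    adj G u b ≡ false → adj G a w ≡ false → Far G u w → FarEndedP4 G
  farEndedP4 {u} {a} {b} {w} u∼a a∼b b∼w u≁b a≁w far = record
    { vertex = vertex ; vertex-adj = vertex-adj ; ends-far = far }
    where
    vertex : Fin 4 → Fin n
    vertex 0F = u
    vertex 1F = a
    vertex 2F = b
    vertex 3F = w

    vertex-adj : ∀ i j → adj G (vertex i) (vertex j) ≡ p4adj i j
    vertex-adj 0F 0F = adjIrrefl G u
    vertex-adj 0F 1F = u∼a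
    vertex-adj 0F 2F = u≁b
    vertex-adj 0F 3F = proj₁ (proj₂ far)
    vertex-adj 1F 0F = ∼-sym G u∼a
    vertex-adj 1F 1F = adjIrrefl G a
    vertex-adj 1F 2F = a∼b
    vertex-adj 1F 3F = a≁w
    vertex-adj 2F 0F = ≁-sym G u≁b
    vertex-adj 2F 1F = ∼-sym G a∼b
    vertex-adj 2F 2F = adjIrrefl G b
    vertex-adj 2F 3F = b∼w
    vertex-adj 3F 0F = ≁-sym G (proj₁ (proj₂ far))
    vertex-adj 3F 1F = ≁-sym G a≁w
    vertex-adj 3F 2F = ∼-sym G b∼w
    vertex-adj 3F 3F = adjIrrefl G w

  -- The walk from x reaches y, so it leaves the vertices far from y; at the
  -- first step x → z that does, z is at distance 2 from y and x at distance 3.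
  walk-far⇒farEndedP4 : ∀ {x y k} → Walk G x y k → Far G x y → FarEndedP4 G
  walk-far⇒farEndedP4 here (x≢x , _) = contradiction refl x≢x
  walk-far⇒farEndedP4 {x} {y} (step {v = z} x∼z walk) far@(_ , x≁y , ¬cn) with z ≟ y
  ... | yes refl = contradiction (trans (sym x∼z) x≁y) λ ()
  ... | no z≢y with adj G z y in z∼?y
  ...   | true  = contradiction (z , x∼z , z∼?y) ¬cn
  ...   | false with commonNeighbour? G z y
  ...     | no ¬cn′ = walk-far⇒farEndedP4 walk (z≢y , z∼?y , ¬cn′)
  ...     | yes (c , z∼c , c∼y) =
    farEndedP4 (∼-sym G c∼y) (∼-sym G z∼c) (∼-sym G x∼z) (≁-sym G z∼?y)
      (¬-not λ c∼x → ¬cn (c , ∼-sym G c∼x , c∼y)) (far-sym G far)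

module _ {n : ℕ} {G : Graph n} (regular : OneMetamourRegular′ G) (P : FarEndedP4 G) where
  open FarEndedP4 P

  vertex-embedding : InducedEmbedding P4 G
  vertex-embedding = twinFree⇒embedding P4-twinFree vertex vertex-adj

  vertex-metamour′⇒partner : ∀ i {y} → Metamour′ G (vertex i) y → y ≡ vertex (P4-partner i)
  vertex-metamour′⇒partner i metamour′ = trans (metamour-unique G regular metamour′)
    (sym (metamour-unique G regular (metamour′-map vertex-embedding (P4-metamour′-partner i))))

  OnPath : Fin n → Set
  OnPath y = ∃ λ i → vertex i ≡ y

  onPath? : ∀ y → Dec (OnPath y)
  onPath? y = any? λ i → vertex i ≟ y

  -- Otherwise y would be a second metamour of vertex k, through vertex j.
  offPath-∼-spreads : ∀ {y} → ¬ OnPath y → ∀ k j →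
    vertex k ∼[ G ] vertex j → y ∼[ G ] vertex j → y ∼[ G ] vertex k
  offPath-∼-spreads {y} off k j k∼j y∼j with adj G y (vertex k) in y∼?k
  ... | true  = refl
  ... | false = contradiction (P4-partner k , sym (vertex-metamour′⇒partner k y-metamour)) off
    where
    y-metamour : Metamour′ G (vertex k) y
    y-metamour = (λ k≡y → off (k , k≡y)) , ≁-sym G y∼?k , vertex j , k∼j , ∼-sym G y∼j

  offPath-≁ : ∀ {y} → ¬ OnPath y → ∀ i → ¬ (y ∼[ G ] vertex i)
  offPath-≁ {y} off i y∼i = proj₂ (proj₂ ends-far) (y , ∼-sym G y∼0 , y∼3)
    where
    spread : ∀ k j → vertex k ∼[ G ] vertex j → y ∼[ G ] vertex j → y ∼[ G ] vertex k
    spread = offPath-∼-spreads off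

    ∼1 : ∀ i → y ∼[ G ] vertex i → y ∼[ G ] vertex 1F
    ∼1 0F y∼0 = spread 1F 0F (vertex-adj 1F 0F) y∼0
    ∼1 1F y∼1 = y∼1
    ∼1 2F y∼2 = spread 1F 2F (vertex-adj 1F 2F) y∼2
    ∼1 3F y∼3 = ∼1 2F (spread 2F 3F (vertex-adj 2F 3F) y∼3)

    y∼0 : y ∼[ G ] vertex 0F
    y∼0 = spread 0F 1F (vertex-adj 0F 1F) (∼1 i y∼i)

    y∼3 : y ∼[ G ] vertex 3F
    y∼3 = spread 3F 2F (vertex-adj 3F 2F) (spread 2F 1F (vertex-adj 2F 1F) (∼1 i y∼i))

  walk-onPath : ∀ {y t k} → Walk G y t k → OnPath t → OnPath y
  walk-onPath here onPath = onPath
  walk-onPath {y} (step {v = z} y∼z walk) onPath with onPath? y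
  ... | yes y-onPath = y-onPath
  ... | no off =
    let i , vertex-i≡z = walk-onPath walk onPath
    in contradiction (subst (y ∼[ G ]_) (sym vertex-i≡z) y∼z) (offPath-≁ off i)

  connected⇒≅P4 : Connected G → G ≅ P4
  connected⇒≅P4 connected = surjective⇒≅ vertex-embedding λ y →
    walk-onPath (proj₂ (connected y (vertex 0F))) (0F , refl)

nonEdges : ∀ {n} → Graph n → EdgeSet n
nonEdges {n} G = record
  { mem    = λ u v → not (adj G u v) ∧ adj (K n) u v
  ; memSym = λ u v → cong₂ (λ a k → not a ∧ k) (adjSym G u v) (adjSym (K n) u v)
  ; memIrr = λ v → trans (cong (not (adj G v v) ∧_) (adjIrrefl (K n) v)) (∧-zeroʳ _)
  }

module _ {n : ℕ} (G : Graph n) where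

  ∈nonEdges : ∀ {u w} → u ≢ w → adj G u w ≡ false → mem (nonEdges G) u w ≡ true
  ∈nonEdges {u} {w} u≢w u≁w with u ≟ w
  ... | yes u≡w = contradiction u≡w u≢w
  ... | no _    rewrite u≁w = refl

  ∈nonEdges⁻¹ : ∀ {u w} → mem (nonEdges G) u w ≡ true → u ≢ w × adj G u w ≡ false
  ∈nonEdges⁻¹ {u} {w} uw∈ with adj G u w | u ≟ w
  ... | true  | _       = contradiction uw∈ λ ()
  ... | false | yes _   = contradiction uw∈ λ ()
  ... | false | no u≢w  = u≢w , refl

  ≅-K-minus-nonEdges : G ≅ (K n minus nonEdges G)
  ≅-K-minus-nonEdges = record { bij = ↔-refl ; preserves = preserves }
    where
    preserves : ∀ u v → adj (K n minus nonEdges G) u v ≡ adj G u v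
    preserves u v with u ≟ v
    ... | yes refl = sym (adjIrrefl G u)
    ... | no _ with adj G u v
    ...   | true  = refl
    ...   | false = refl

  nonEdges-perfectMatching : OneMetamourRegular′ G → (∀ u w → ¬ Far G u w) →
    PerfectMatching (nonEdges G)
  nonEdges-perfectMatching regular noFar v =
    metamour G regular v ,
    ∈nonEdges v≢m v≁m ,
    λ w vw∈ → let v≢w , v≁w = ∈nonEdges⁻¹ vw∈
              in metamour-unique G regular (v≢w , v≁w , commonNeighbour v≢w v≁w)
    where
    v≢m : v ≢ metamour G regular v
    v≢m = proj₁ (metamour-metamour′ G regular v)

    v≁m : adj G v (metamour G regular v) ≡ false
    v≁m = proj₁ (proj₂ (metamour-metamour′ G regular v))

    commonNeighbour : ∀ {w} → v ≢ w → adj G v w ≡ false → CommonNeighbour G v w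
    commonNeighbour {w} v≢w v≁w with commonNeighbour? G v w
    ... | yes cn = cn
    ... | no ¬cn = contradiction (v≢w , v≁w , ¬cn) (noFar v w)

oneMetamourRegular′⇒classification : ∀ {n} {G : Graph n} → Connected G → OneMetamourRegular′ G →
  G ≅ P4 ⊎ Σ (EdgeSet n) (λ μ → PerfectMatching μ × (G ≅ (K n minus μ)))
oneMetamourRegular′⇒classification {G = G} connected regular with any? (λ u → any? (far? G u))
... | yes (u , w , far) =
  inj₁ (connected⇒≅P4 regular (walk-far⇒farEndedP4 (proj₂ (connected u w)) far) connected)
... | no ¬far =
  inj₂ (nonEdges G ,
        nonEdges-perfectMatching G regular (λ u w far → ¬far (u , w , far)) ,
        ≅-K-minus-nonEdges G)

theorem3p5 : (n : ℕ) → n ≥ 1 → (G : Graph n) → Connected G →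
    OneMetamourRegular G ⇔
      ((n ≥ 4 × 2 ∣ n) ×
       (G ≅ P4 ⊎ Σ (EdgeSet n) (λ μ → PerfectMatching μ × (G ≅ (K n minus μ)))))
theorem3p5 (suc _) _ G connected = mk⇔
  (λ regular →
    let regular′ = to regular
        even     = oneMetamourRegular′⇒even G regular′
    in (even∧≥3⇒≥4 even (oneMetamourRegular′⇒≥3 G regular′ 0F) , even) ,
       oneMetamourRegular′⇒classification connected regular′)
  λ { (_ , inj₁ G≅P4) →
        from (oneMetamourRegular′-resp-≅ G≅P4 P4-oneMetamourRegular′)
    ; ((n≥4 , _) , inj₂ (μ , perfect , G≅K-μ)) →
        from (oneMetamourRegular′-resp-≅ G≅K-μ
          (K-minus-oneMetamourRegular′ {μ = μ} perfect (<⇒≤ n≥4))) }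
  where open Equivalence (oneMetamourRegular⇔oneMetamourRegular′ G)
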